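{- If $G$ is a graph with minimum degree $\delta(G)\ge 2$, then $\Gamma_{\rm cer}(G)\le\Gamma(G)$.
   Context: All graphs are finite and simple. A dominating set of $G$ is a set $D\subseteq V_G$ such that every vertex of $V_G-D$ has a neighbor in $D$; $\Gamma(G)$ is the maximum cardinality of a minimal (with respect to inclusion) dominating set. A certified dominating set is a dominating set $D$ such that every vertex in $D$ has either zero or at least two neighbors in $V_G-D$; $\Gamma_{\rm cer}(G)$ is the maximum cardinality of a minimal (with respect to inclusion) certified dominating set of $G$. -}

module Defs where

open import Data.Nat using (ℕ; _≤_)
open import Data.Bool using (Bool; true; false; T; not)
open import Data.Fin using (Fin)
open import Data.Fin.Subset using (Subset; _∈_; _∉_; _⊂_; _∩_; ∁; ∣_∣)
open import Data.Vec using (tabulate)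
open import Data.Product using (Σ; ∃; _×_; _,_)
open import Data.Sum using (_⊎_)
open import Relation.Binary.PropositionalEquality using (_≡_)
open import Relation.Nullary using (¬_)

record Graph (n : ℕ) : Set where
  field
    adj   : Fin n → Fin n → Bool
    sym   : ∀ u v → adj u v ≡ adj v u
    irrefl : ∀ v → adj v v ≡ false

module _ {n : ℕ} (G : Graph n) where
  open Graph G

  N : Fin n → Subset n
  N v = tabulate (adj v)

  degree : Fin n → ℕ
  degree v = ∣ N v ∣

  MinDegree≥ : ℕ → Set
  MinDegree≥ k = ∀ v → k ≤ degree v

  Dominating : Subset n → Set
  Dominating D = ∀ v → v ∉ D → ∃ λ u → u ∈ D × T (adj v u)

  CertifiedDominating : Subset n → Set
  CertifiedDominating D =
    Dominating D × (∀ v → v ∈ D → (∣ N v ∩ ∁ D ∣ ≡ 0) ⊎ (2 ≤ ∣ N v ∩ ∁ D ∣))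

  MinimalDominating : Subset n → Set
  MinimalDominating D = Dominating D × (∀ D' → D' ⊂ D → ¬ Dominating D')

  MinimalCertifiedDominating : Subset n → Set
  MinimalCertifiedDominating D =
    CertifiedDominating D × (∀ D' → D' ⊂ D → ¬ CertifiedDominating D')

{-# OPTIONS --safe #-}
-- Let D be a minimal certified dominating set of a graph with minimum degree at least 2,
-- and call v ∈ D interior when all neighbours of v lie in D. If some vertex is interior,
-- a local search (add a vertex, or trade one vertex for another) finds a nonempty set X
-- of interior vertices such that each vertex of X has a neighbour outside X and no
-- interior vertex outside X has exactly one neighbour in X. Then D ─ X is still certified
-- dominating, contradicting minimality. Hence every vertex of D has at least two
-- neighbours outside D, and therefore outside any subset of D. So if a proper subset of D
-- dominated, D - w would be certified dominating for some w ∈ D. Thus D is itself a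
-- minimal dominating set.

module Submission where

open import Defs
open import Data.Nat using (ℕ; zero; suc; _≤_; _<_; _∸_; z≤n; s≤s)
open import Data.Nat.Properties
  using (_≟_; ≤-refl; ≤-trans; ≤-pred; ≤-reflexive; n≤1+n; <-irrefl; >⇒≢; m≤n⇒m<n∨m≡n; ∸-monoʳ-<)
open import Data.Nat.Induction using (<-wellFounded)
open import Data.Fin as Fin using (Fin) renaming (_≟_ to _≟ᶠ_)
open import Data.Fin.Subset
  using (Subset; _∈_; _∉_; _⊆_; _⊂_; _∩_; _∪_; _─_; _-_; ∁; ⁅_⁆; ∣_∣; Nonempty; Empty; inside; outside)
open import Data.Fin.Subset.Properties
open import Data.Fin.Properties using (any?)
open import Data.Bool using (Bool; T)
open import Data.Bool.Properties using (T-≡)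
open import Data.Vec using (_∷_; tabulate; here; there)
open import Data.Vec.Properties using (lookup⇒[]=; []=⇒lookup; lookup∘tabulate)
open import Data.Product using (∃; _×_; _,_; proj₁; proj₂)
open import Data.Product.Relation.Binary.Lex.Strict using (×-Lex; ×-wellFounded)
open import Data.Sum using (_⊎_; inj₁; inj₂)
open import Function using (_∘_; _on_)
open import Function.Bundles using (Equivalence)
open import Induction.WellFounded using (WellFounded; Acc; acc)
open import Relation.Binary.Construct.On as On using ()
open import Relation.Binary.PropositionalEquality using (_≡_; _≢_; refl; sym; trans; subst; cong)
open import Relation.Nullary using (yes; no; contradiction)
open import Relation.Nullary.Decidable using (decidable-stable; isYes; toWitness; fromWitness; T?; ¬?; _×-dec_)
open import Relation.Unary using (Decidable)

∈-tabulate⁺ : ∀ {n} (f : Fin n → Bool) {x} → T (f x) → x ∈ tabulate f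
∈-tabulate⁺ f {x} t = lookup⇒[]= x (tabulate f) (trans (lookup∘tabulate f x) (Equivalence.to T-≡ t))

∈-tabulate⁻ : ∀ {n} (f : Fin n → Bool) {x} → x ∈ tabulate f → T (f x)
∈-tabulate⁻ f {x} x∈ = Equivalence.from T-≡ (trans (sym (lookup∘tabulate f x)) ([]=⇒lookup x∈))

x∈p─q⁻ : ∀ {n} (p q : Subset n) {x} → x ∈ p ─ q → x ∈ p × x ∉ q
x∈p─q⁻ (inside ∷ p) (outside ∷ q) here = here , λ ()
x∈p─q⁻ (_ ∷ p) (inside ∷ q) {Fin.zero} ()
x∈p─q⁻ (outside ∷ p) (outside ∷ q) {Fin.zero} ()
x∈p─q⁻ (_ ∷ p) (_ ∷ q) (there x∈) with x∈p─q⁻ p q x∈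
... | x∈p , x∉q = there x∈p , λ { (there x∈q) → x∉q x∈q }

x∈p-y⁻ : ∀ {n} {p : Subset n} {x y} → x ∈ p - y → x ∈ p × x ≢ y
x∈p-y⁻ {p = p} {y = y} x∈ with x∈p─q⁻ p ⁅ y ⁆ x∈
... | x∈p , x∉⁅y⁆ = x∈p , x∉⁅y⁆⇒x≢y x∉⁅y⁆

x∉p-x : ∀ {n} {p : Subset n} {x} → x ∉ p - x
x∉p-x x∈ = proj₂ (x∈p-y⁻ x∈) refl

x∈p∪⁅y⁆⁻ : ∀ {n} {p : Subset n} {x y} → x ∈ p ∪ ⁅ y ⁆ → x ∈ p ⊎ x ≡ y
x∈p∪⁅y⁆⁻ {p = p} {y = y} x∈ with x∈p∪q⁻ p ⁅ y ⁆ x∈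
... | inj₁ x∈p = inj₁ x∈p
... | inj₂ x∈⁅y⁆ = inj₂ (x∈⁅y⁆⇒x≡y y x∈⁅y⁆)

x∉p∪⁅y⁆ : ∀ {n} {p : Subset n} {x y} → x ∉ p → x ≢ y → x ∉ p ∪ ⁅ y ⁆
x∉p∪⁅y⁆ x∉p x≢y x∈ with x∈p∪⁅y⁆⁻ x∈
... | inj₁ x∈p = x∉p x∈p
... | inj₂ x≡y = x≢y x≡y

y∈p∪⁅y⁆ : ∀ {n} (p : Subset n) y → y ∈ p ∪ ⁅ y ⁆
y∈p∪⁅y⁆ p y = x∈p∪q⁺ (inj₂ (x∈⁅x⁆ y))

p⊂p∪⁅y⁆ : ∀ {n} {p : Subset n} {y} → y ∉ p → p ⊂ p ∪ ⁅ y ⁆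
p⊂p∪⁅y⁆ {p = p} {y} y∉p = p⊆p∪q ⁅ y ⁆ , y , y∈p∪⁅y⁆ p y , y∉p

x∈p⇒⁅x⁆⊆p : ∀ {n} {p : Subset n} {x} → x ∈ p → ⁅ x ⁆ ⊆ p
x∈p⇒⁅x⁆⊆p {p = p} {x} x∈p y∈⁅x⁆ = subst (_∈ p) (sym (x∈⁅y⁆⇒x≡y x y∈⁅x⁆)) x∈p

x∈p⇒0<∣p∣ : ∀ {n} {p : Subset n} {x} → x ∈ p → 0 < ∣ p ∣
x∈p⇒0<∣p∣ {p = p} {x} x∈p = subst (_≤ ∣ p ∣) (∣⁅x⁆∣≡1 x) (p⊆q⇒∣p∣≤∣q∣ (x∈p⇒⁅x⁆⊆p x∈p))

0<∣p∣⇒nonempty : ∀ {n} (p : Subset n) → 0 < ∣ p ∣ → Nonempty p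
0<∣p∣⇒nonempty {n} p 0<∣p∣ with nonempty? p
... | yes ne = ne
... | no ¬ne = contradiction (trans (cong ∣_∣ (Empty-unique ¬ne)) (∣⊥∣≡0 n)) (>⇒≢ 0<∣p∣)

∣p∣≤1+∣p-x∣ : ∀ {n} (p : Subset n) x → ∣ p ∣ ≤ suc ∣ p - x ∣
∣p∣≤1+∣p-x∣ (s ∷ p) Fin.zero =
  subst (λ q → ∣ s ∷ p ∣ ≤ suc ∣ q ∣) (sym (p─⊥≡p p)) (∣s∷p∣≤1+∣p∣ s)
  where
  ∣s∷p∣≤1+∣p∣ : ∀ s → ∣ s ∷ p ∣ ≤ suc ∣ p ∣
  ∣s∷p∣≤1+∣p∣ inside  = ≤-refl
  ∣s∷p∣≤1+∣p∣ outside = n≤1+n _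
∣p∣≤1+∣p-x∣ (inside  ∷ p) (Fin.suc x) = s≤s (∣p∣≤1+∣p-x∣ p x)
∣p∣≤1+∣p-x∣ (outside ∷ p) (Fin.suc x) = ∣p∣≤1+∣p-x∣ p x

2≤∣p∣⇒∃≢ : ∀ {n} (p : Subset n) → 2 ≤ ∣ p ∣ → ∀ y → ∃ λ x → x ∈ p × x ≢ y
2≤∣p∣⇒∃≢ p 2≤∣p∣ y with 0<∣p∣⇒nonempty (p - y) (≤-pred (≤-trans 2≤∣p∣ (∣p∣≤1+∣p-x∣ p y)))
... | x , x∈p-y = x , x∈p-y⁻ x∈p-y

∣p∣≡1⇒p≡⁅x⁆ : ∀ {n} (p : Subset n) → ∣ p ∣ ≡ 1 → ∃ λ x → p ≡ ⁅ x ⁆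
∣p∣≡1⇒p≡⁅x⁆ p ∣p∣≡1 with 0<∣p∣⇒nonempty p (≤-reflexive (sym ∣p∣≡1))
... | x , x∈p = x , ⊆-antisym p⊆⁅x⁆ (x∈p⇒⁅x⁆⊆p x∈p)
  where
  p⊆⁅x⁆ : p ⊆ ⁅ x ⁆
  p⊆⁅x⁆ {y} y∈p with y ≟ᶠ x
  ... | yes refl = x∈⁅x⁆ x
  ... | no y≢x = contradiction (p⊂q⇒∣p∣<∣q∣ (x∈p⇒⁅x⁆⊆p x∈p , y , y∈p , x≢y⇒x∉⁅y⁆ y≢x))
                   (<-irrefl (trans (∣⁅x⁆∣≡1 x) (sym ∣p∣≡1)))

∣p∩∁q∣≡0⇒p⊆q : ∀ {n} (p q : Subset n) → ∣ p ∩ ∁ q ∣ ≡ 0 → p ⊆ q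
∣p∩∁q∣≡0⇒p⊆q p q ∣p∩∁q∣≡0 {x} x∈p with x ∈? q
... | yes x∈q = x∈q
... | no x∉q = contradiction ∣p∩∁q∣≡0 (>⇒≢ (x∈p⇒0<∣p∣ (x∈p∩q⁺ (x∈p , x∉p⇒x∈∁p x∉q))))

q⊆r⇒∣p∩∁r∣≤∣p∩∁q∣ : ∀ {n} (p : Subset n) {q r} → q ⊆ r → ∣ p ∩ ∁ r ∣ ≤ ∣ p ∩ ∁ q ∣
q⊆r⇒∣p∩∁r∣≤∣p∩∁q∣ p {q} {r} q⊆r = p⊆q⇒∣p∣≤∣q∣ λ x∈ →
  let x∈p , x∈∁r = x∈p∩q⁻ p (∁ r) x∈ in x∈p∩q⁺ (x∈p , p⊆q⇒∁p⊇∁q q⊆r x∈∁r)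

p⊆q⇒p∩∁[q─r]≡p∩r : ∀ {n} {p q : Subset n} r → p ⊆ q → p ∩ ∁ (q ─ r) ≡ p ∩ r
p⊆q⇒p∩∁[q─r]≡p∩r {p = p} {q} r p⊆q = ⊆-antisym forth back
  where
  forth : p ∩ ∁ (q ─ r) ⊆ p ∩ r
  forth {x} x∈ with x∈p∩q⁻ p (∁ (q ─ r)) x∈
  ... | x∈p , x∉q─r with x ∈? r
  ...   | yes x∈r = x∈p∩q⁺ (x∈p , x∈r)
  ...   | no x∉r = contradiction (x∈p∧x∉q⇒x∈p─q (p⊆q x∈p) x∉r) (x∈∁p⇒x∉p x∉q─r)
  back : p ∩ r ⊆ p ∩ ∁ (q ─ r)
  back x∈ with x∈p∩q⁻ p r x∈
  ... | x∈p , x∈r = x∈p∩q⁺ (x∈p , x∉p⇒x∈∁p λ x∈q─r → proj₂ (x∈p─q⁻ q r x∈q─r) x∈r)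

ZeroOrAtLeastTwo : ℕ → Set
ZeroOrAtLeastTwo m = m ≡ 0 ⊎ 2 ≤ m

≢1⇒zeroOrAtLeastTwo : ∀ {m} → m ≢ 1 → ZeroOrAtLeastTwo m
≢1⇒zeroOrAtLeastTwo {zero}        _   = inj₁ refl
≢1⇒zeroOrAtLeastTwo {suc zero}    m≢1 = contradiction refl m≢1
≢1⇒zeroOrAtLeastTwo {suc (suc m)} _   = inj₂ (s≤s (s≤s z≤n))

module _ {n : ℕ} (G : Graph n) where
  open Graph G using (adj; irrefl) renaming (sym to adj-comm)

  Adj : Fin n → Fin n → Set
  Adj u v = T (adj u v)

  Adj⇒∈N : ∀ {v z} → Adj v z → z ∈ N G v
  Adj⇒∈N {v} = ∈-tabulate⁺ (adj v)

  ∈N⇒Adj : ∀ {v z} → z ∈ N G v → Adj v z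
  ∈N⇒Adj {v} = ∈-tabulate⁻ (adj v)

  Adj-sym : ∀ {v z} → Adj v z → Adj z v
  Adj-sym {v} {z} = subst T (adj-comm v z)

  Adj⇒≢ : ∀ {v z} → Adj v z → v ≢ z
  Adj⇒≢ {v} v~v refl = subst T (irrefl v) v~v

  neighbour-≢ : MinDegree≥ G 2 → ∀ v y → ∃ λ z → Adj v z × z ≢ y
  neighbour-≢ δ≥2 v y with 2≤∣p∣⇒∃≢ (N G v) (δ≥2 v) y
  ... | z , z∈Nv , z≢y = z , ∈N⇒Adj z∈Nv , z≢y

  Escaping : Subset n → Set
  Escaping X = ∀ {x} → x ∈ X → ∃ λ z → Adj x z × z ∉ X

  record EscapingSubset (A X : Subset n) : Set where
    field
      ⊆A       : X ⊆ A
      nonempty : Nonempty X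
      escaping : Escaping X

  Balanced : Subset n → Subset n → Set
  Balanced A X = ∀ {u} → u ∈ A → u ∉ X → ∣ N G u ∩ X ∣ ≢ 1

  HasNeighbourIn : Subset n → Fin n → Set
  HasNeighbourIn X y = ∃ λ z → Adj y z × z ∈ X

  hasNeighbourIn? : ∀ X → Decidable (HasNeighbourIn X)
  hasNeighbourIn? X y = any? λ z → T? (adj y z) ×-dec z ∈? X

  nonIsolated : Subset n → Subset n
  nonIsolated X = X ∩ tabulate (isYes ∘ hasNeighbourIn? X)

  ∈nonIsolated⁺ : ∀ {X y z} → y ∈ X → Adj y z → z ∈ X → y ∈ nonIsolated X
  ∈nonIsolated⁺ {X} y∈X y~z z∈X =
    x∈p∩q⁺ (y∈X , ∈-tabulate⁺ (isYes ∘ hasNeighbourIn? X) (fromWitness (_ , y~z , z∈X)))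

  ∈nonIsolated⁻ : ∀ {X y} → y ∈ nonIsolated X → y ∈ X × HasNeighbourIn X y
  ∈nonIsolated⁻ {X} y∈ with x∈p∩q⁻ X _ y∈
  ... | y∈X , has = y∈X , toWitness (∈-tabulate⁻ (isYes ∘ hasNeighbourIn? X) has)

  measure : Subset n → ℕ × ℕ
  measure X = n ∸ ∣ X ∣ , ∣ nonIsolated X ∣

  -- A search step either enlarges X or keeps its size and shrinks nonIsolated X.
  infix 4 _≺_
  _≺_ : Subset n → Subset n → Set
  _≺_ = ×-Lex _≡_ _<_ _<_ on measure

  ≺-wellFounded : WellFounded _≺_
  ≺-wellFounded = On.wellFounded measure (×-wellFounded <-wellFounded <-wellFounded)

  size-<⇒≺ : ∀ {X Y} → ∣ X ∣ < ∣ Y ∣ → Y ≺ X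
  size-<⇒≺ {Y = Y} ∣X∣<∣Y∣ = inj₁ (∸-monoʳ-< ∣X∣<∣Y∣ (∣p∣≤n Y))

  nonIsolated-<⇒≺ : ∀ {X Y} → ∣ X ∣ ≤ ∣ Y ∣ → ∣ nonIsolated Y ∣ < ∣ nonIsolated X ∣ → Y ≺ X
  nonIsolated-<⇒≺ {X} {Y} ∣X∣≤∣Y∣ lt with m≤n⇒m<n∨m≡n ∣X∣≤∣Y∣
  ... | inj₁ ∣X∣<∣Y∣ = size-<⇒≺ {X} {Y} ∣X∣<∣Y∣
  ... | inj₂ ∣X∣≡∣Y∣ = inj₂ (cong (n ∸_) (sym ∣X∣≡∣Y∣) , lt)

  -- x is the only neighbour of u in X. If x has another neighbour outside X, add u;
  -- otherwise trade x for u, which makes x leave nonIsolated X and adds nothing to it.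
  module Improve (δ≥2 : MinDegree≥ G 2) {A X : Subset n} (S : EscapingSubset A X)
                 {u x : Fin n} (u∈A : u ∈ A) (u∉X : u ∉ X) (Nu∩X≡⁅x⁆ : N G u ∩ X ≡ ⁅ x ⁆) where
    open EscapingSubset S

    only-x : ∀ {y} → Adj u y → y ∈ X → y ≡ x
    only-x u~y y∈X = x∈⁅y⁆⇒x≡y x (subst (_ ∈_) Nu∩X≡⁅x⁆ (x∈p∩q⁺ (Adj⇒∈N u~y , y∈X)))

    x∈Nu∩X : x ∈ N G u ∩ X
    x∈Nu∩X = subst (x ∈_) (sym Nu∩X≡⁅x⁆) (x∈⁅x⁆ x)

    u~x : Adj u x
    u~x = ∈N⇒Adj (proj₁ (x∈p∩q⁻ (N G u) X x∈Nu∩X))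

    x∈X : x ∈ X
    x∈X = proj₂ (x∈p∩q⁻ (N G u) X x∈Nu∩X)

    x≢u : x ≢ u
    x≢u refl = u∉X x∈X

    sees-u⇒≡x : ∀ {y} → y ∈ X → Adj y u → y ≡ x
    sees-u⇒≡x y∈X y~u = only-x (Adj-sym y~u) y∈X

    ∪⁅u⁆⊆A : ∀ {Y} → Y ⊆ X → Y ∪ ⁅ u ⁆ ⊆ A
    ∪⁅u⁆⊆A Y⊆X y∈ with x∈p∪⁅y⁆⁻ y∈
    ... | inj₁ y∈Y = ⊆A (Y⊆X y∈Y)
    ... | inj₂ refl = u∈A

    grow : (∃ λ z → Adj x z × z ∉ X × z ≢ u) → EscapingSubset A (X ∪ ⁅ u ⁆)
    grow (z₀ , x~z₀ , z₀∉X , z₀≢u) = record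
      { ⊆A = ∪⁅u⁆⊆A ⊆-refl ; nonempty = u , y∈p∪⁅y⁆ X u ; escaping = escaping′ }
      where
      escaping′ : Escaping (X ∪ ⁅ u ⁆)
      escaping′ y∈ with x∈p∪⁅y⁆⁻ y∈
      ... | inj₂ refl with neighbour-≢ δ≥2 u x
      ...   | z , u~z , z≢x = z , u~z , x∉p∪⁅y⁆ (z≢x ∘ only-x u~z) (Adj⇒≢ u~z ∘ sym)
      escaping′ {y} _ | inj₁ y∈X with y ≟ᶠ x
      ...   | yes refl = z₀ , x~z₀ , x∉p∪⁅y⁆ z₀∉X z₀≢u
      ...   | no y≢x with escaping y∈X
      ...     | z , y~z , z∉X =
        z , y~z , x∉p∪⁅y⁆ z∉X (λ { refl → y≢x (sees-u⇒≡x y∈X y~z) })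

    grow-≺ : X ∪ ⁅ u ⁆ ≺ X
    grow-≺ = size-<⇒≺ {X} {X ∪ ⁅ u ⁆} (p⊂q⇒∣p∣<∣q∣ (p⊂p∪⁅y⁆ u∉X))

    swap : EscapingSubset A ((X - x) ∪ ⁅ u ⁆)
    swap = record
      { ⊆A = ∪⁅u⁆⊆A (proj₁ ∘ x∈p-y⁻) ; nonempty = u , y∈p∪⁅y⁆ (X - x) u ; escaping = escaping′ }
      where
      escaping′ : Escaping ((X - x) ∪ ⁅ u ⁆)
      escaping′ y∈ with x∈p∪⁅y⁆⁻ y∈
      ... | inj₂ refl = x , u~x , x∉p∪⁅y⁆ x∉p-x x≢u
      ... | inj₁ y∈X-x with x∈p-y⁻ y∈X-x
      ...   | y∈X , y≢x with escaping y∈X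
      ...     | z , y~z , z∉X =
        z , y~z , x∉p∪⁅y⁆ (z∉X ∘ proj₁ ∘ x∈p-y⁻) (λ { refl → y≢x (sees-u⇒≡x y∈X y~z) })

    swap-≺ : (∀ {z} → Adj x z → z ∉ X → z ≡ u) → (X - x) ∪ ⁅ u ⁆ ≺ X
    swap-≺ only-u = nonIsolated-<⇒≺ {X} {X′} ∣X∣≤∣X′∣
      (p⊂q⇒∣p∣<∣q∣ (nonIsolated-⊆ , x , x∈nonIsolated , x∉nonIsolated′))
      where
      X′ = (X - x) ∪ ⁅ u ⁆

      ∣X∣≤∣X′∣ : ∣ X ∣ ≤ ∣ X′ ∣
      ∣X∣≤∣X′∣ = ≤-trans (∣p∣≤1+∣p-x∣ X x) (p⊂q⇒∣p∣<∣q∣ (p⊂p∪⁅y⁆ (u∉X ∘ proj₁ ∘ x∈p-y⁻)))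

      x∈nonIsolated : x ∈ nonIsolated X
      x∈nonIsolated with neighbour-≢ δ≥2 x u
      ... | z , x~z , z≢u with z ∈? X
      ...   | yes z∈X = ∈nonIsolated⁺ x∈X x~z z∈X
      ...   | no z∉X = contradiction (only-u x~z z∉X) z≢u

      x∉nonIsolated′ : x ∉ nonIsolated X′
      x∉nonIsolated′ x∈ = x∉p∪⁅y⁆ x∉p-x x≢u (proj₁ (∈nonIsolated⁻ x∈))

      nonIsolated-⊆ : nonIsolated X′ ⊆ nonIsolated X
      nonIsolated-⊆ y∈ with ∈nonIsolated⁻ y∈
      ... | y∈X′ , z , y~z , z∈X′ with x∈p∪⁅y⁆⁻ y∈X′ | x∈p∪⁅y⁆⁻ z∈X′
      ... | inj₁ y∈X-x | inj₁ z∈X-x = ∈nonIsolated⁺ (proj₁ (x∈p-y⁻ y∈X-x)) y~z (proj₁ (x∈p-y⁻ z∈X-x))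
      ... | inj₁ y∈X-x | inj₂ refl =
        let y∈X , y≢x = x∈p-y⁻ y∈X-x in contradiction (sees-u⇒≡x y∈X y~z) y≢x
      ... | inj₂ refl | inj₁ z∈X-x =
        let z∈X , z≢x = x∈p-y⁻ z∈X-x in contradiction (only-x y~z z∈X) z≢x
      ... | inj₂ refl | inj₂ refl = contradiction refl (Adj⇒≢ y~z)

    improved : ∃ λ Y → EscapingSubset A Y × Y ≺ X
    improved with any? (λ z → T? (adj x z) ×-dec ¬? (z ∈? X) ×-dec ¬? (z ≟ᶠ u))
    ... | yes other = X ∪ ⁅ u ⁆ , grow other , grow-≺
    ... | no ¬other = (X - x) ∪ ⁅ u ⁆ , swap , swap-≺ only-u
      where
      only-u : ∀ {z} → Adj x z → z ∉ X → z ≡ u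
      only-u {z} x~z z∉X = decidable-stable (z ≟ᶠ u) λ z≢u → ¬other (z , x~z , z∉X , z≢u)

  balanced-escaping-subset : MinDegree≥ G 2 → ∀ {A} → Nonempty A →
                             ∃ λ X → EscapingSubset A X × Balanced A X
  balanced-escaping-subset δ≥2 {A} (a , a∈A) = search (≺-wellFounded ⁅ a ⁆) seed
    where
    seed : EscapingSubset A ⁅ a ⁆
    seed = record { ⊆A = x∈p⇒⁅x⁆⊆p a∈A ; nonempty = a , x∈⁅x⁆ a ; escaping = escaping′ }
      where
      escaping′ : Escaping ⁅ a ⁆
      escaping′ y∈ with x∈⁅y⁆⇒x≡y a y∈ | neighbour-≢ δ≥2 a a
      ... | refl | z , a~z , z≢a = z , a~z , x≢y⇒x∉⁅y⁆ z≢a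

    search : ∀ {X} → Acc _≺_ X → EscapingSubset A X → ∃ λ X → EscapingSubset A X × Balanced A X
    search {X} (acc rs) S with any? (λ u → u ∈? A ×-dec ¬? (u ∈? X) ×-dec (∣ N G u ∩ X ∣ ≟ 1))
    ... | no ¬once = X , S , λ u∈A u∉X once → ¬once (_ , u∈A , u∉X , once)
    ... | yes (u , u∈A , u∉X , once) with ∣p∣≡1⇒p≡⁅x⁆ (N G u ∩ X) once
    ...   | x , Nu∩X≡⁅x⁆ with Improve.improved δ≥2 S u∈A u∉X Nu∩X≡⁅x⁆
    ...     | Y , S′ , Y≺X = search (rs Y≺X) S′

  interior : Subset n → Subset n
  interior D = D ∩ tabulate (λ w → isYes (N G w ⊆? D))

  ∈interior⁺ : ∀ {D v} → v ∈ D → N G v ⊆ D → v ∈ interior D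
  ∈interior⁺ {D} {v} v∈D Nv⊆D =
    x∈p∩q⁺ (v∈D , ∈-tabulate⁺ (λ w → isYes (N G w ⊆? D)) (fromWitness {a? = N G v ⊆? D} Nv⊆D))

  ∈interior⁻ : ∀ {D v} → v ∈ interior D → v ∈ D × N G v ⊆ D
  ∈interior⁻ {D} v∈ with x∈p∩q⁻ D _ v∈
  ... | v∈D , Nv⊆D = v∈D , toWitness (∈-tabulate⁻ (λ w → isYes (N G w ⊆? D)) Nv⊆D)

  Certified : Subset n → Set
  Certified D = ∀ v → v ∈ D → ZeroOrAtLeastTwo ∣ N G v ∩ ∁ D ∣

  ∉interior⇒2≤∣N∩∁D∣ : ∀ {D v} → Certified D → v ∈ D → v ∉ interior D → 2 ≤ ∣ N G v ∩ ∁ D ∣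
  ∉interior⇒2≤∣N∩∁D∣ {D} {v} cert v∈D v∉int with cert v v∈D
  ... | inj₂ 2≤ = 2≤
  ... | inj₁ ≡0 = contradiction (∈interior⁺ v∈D (∣p∩∁q∣≡0⇒p⊆q (N G v) D ≡0)) v∉int

  ⊆-dominating : ∀ {D E} → D ⊆ E → Dominating G D → Dominating G E
  ⊆-dominating D⊆E dom v v∉E with dom v (v∉E ∘ D⊆E)
  ... | u , u∈D , v~u = u , D⊆E u∈D , v~u

  ─-dominating : ∀ {D X} → Dominating G D → X ⊆ interior D → Escaping X → Dominating G (D ─ X)
  ─-dominating {D} {X} dom X⊆int esc v v∉D─X with v ∈? D | v ∈? X
  ... | yes v∈D | no v∉X = contradiction (x∈p∧x∉q⇒x∈p─q v∈D v∉X) v∉D─X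
  ... | _ | yes v∈X with esc v∈X
  ...   | z , v~z , z∉X = z , x∈p∧x∉q⇒x∈p─q (proj₂ (∈interior⁻ (X⊆int v∈X)) (Adj⇒∈N v~z)) z∉X , v~z
  ─-dominating {D} {X} dom X⊆int esc v v∉D─X | no v∉D | no _ with dom v v∉D
  ...   | u , u∈D , v~u with u ∈? X
  ...     | no u∉X = u , x∈p∧x∉q⇒x∈p─q u∈D u∉X , v~u
  ...     | yes u∈X = contradiction (proj₂ (∈interior⁻ (X⊆int u∈X)) (Adj⇒∈N (Adj-sym v~u))) v∉D

  ─-certified : ∀ {D X} → Certified D → Balanced (interior D) X → Certified (D ─ X)
  ─-certified {D} {X} cert bal w w∈D─X with x∈p─q⁻ D X w∈D─X | w ∈? interior D
  ... | w∈D , w∉X | no w∉int =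
    inj₂ (≤-trans (∉interior⇒2≤∣N∩∁D∣ cert w∈D w∉int) (q⊆r⇒∣p∩∁r∣≤∣p∩∁q∣ (N G w) (p─q⊆p D X)))
  ... | w∈D , w∉X | yes w∈int =
    subst ZeroOrAtLeastTwo (sym (cong ∣_∣ (p⊆q⇒p∩∁[q─r]≡p∩r X (proj₂ (∈interior⁻ w∈int)))))
      (≢1⇒zeroOrAtLeastTwo (bal w∈int w∉X))

  ⊆-certified : ∀ {D E} → Certified D → Empty (interior D) → E ⊆ D → Certified E
  ⊆-certified cert empty E⊆D v v∈E = inj₂ (≤-trans
    (∉interior⇒2≤∣N∩∁D∣ cert (E⊆D v∈E) (λ v∈int → empty (v , v∈int)))
    (q⊆r⇒∣p∩∁r∣≤∣p∩∁q∣ (N G v) E⊆D))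

  minimalCertified⇒empty-interior : MinDegree≥ G 2 → ∀ {D} →
                                    MinimalCertifiedDominating G D → Empty (interior D)
  minimalCertified⇒empty-interior δ≥2 {D} ((dom , cert) , minimal) (v , v∈int)
    with balanced-escaping-subset δ≥2 (v , v∈int)
  ... | X , S , bal = minimal (D ─ X) D─X⊂D (─-dominating dom ⊆A escaping , ─-certified cert bal)
    where
    open EscapingSubset S
    D─X⊂D : D ─ X ⊂ D
    D─X⊂D with nonempty
    ... | x , x∈X = p∩q≢∅⇒p─q⊂p D X (x , x∈p∩q⁺ (proj₁ (∈interior⁻ (⊆A x∈X)) , x∈X))

  minimalCertified⇒minimalDominating : MinDegree≥ G 2 → ∀ {D} →
                                       MinimalCertifiedDominating G D → MinimalDominating G D
  minimalCertified⇒minimalDominating δ≥2 {D} mcd@((dom , cert) , minimal) =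
    dom , λ { D′ (D′⊆D , w , w∈D , w∉D′) dom′ →
      minimal (D - w) (x∈p⇒p-x⊂p w∈D)
        ( ⊆-dominating (λ y∈D′ → x∈p∧x≢y⇒x∈p-y (D′⊆D y∈D′) λ { refl → w∉D′ y∈D′ }) dom′
        , ⊆-certified cert (minimalCertified⇒empty-interior δ≥2 mcd) (p─q⊆p D ⁅ w ⁆) ) }

lemma3p4 : ∀ {n : ℕ} (G : Graph n) → MinDegree≥ G 2 →
    ∀ (D : Subset n) → MinimalCertifiedDominating G D →
    ∃ λ (D' : Subset n) → MinimalDominating G D' × ∣ D ∣ ≤ ∣ D' ∣
lemma3p4 G δ≥2 D mcd = D , minimalCertified⇒minimalDominating G δ≥2 mcd , ≤-refl
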